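{- There exist connected graphs $G$ and $H$ such that $H\subset G$ ($H$ is a subgraph of $G$) and $\mathrm{edim}(G)<\mathrm{edim}(H)$.
   Context: All graphs are finite, simple, undirected and connected; $d(u,w)$ is the length of a shortest $u$–$w$ path. For a vertex $v$ and an edge $e=xy$, $d(e,v)=\min\{d(x,v),d(y,v)\}$. For distinct edges $e_1,e_2$, $R_e\{e_1,e_2\}=\{v\in V(G): d(v,e_1)\neq d(v,e_2)\}$. A set $S\subseteq V(G)$ is an edge resolving set of $G$ if $S\cap R_e\{e_1,e_2\}\neq\emptyset$ for all distinct edges $e_1,e_2\in E(G)$; the edge dimension $\mathrm{edim}(G)$ is the minimum cardinality of an edge resolving set of $G$. -}

module Defs where

open import Data.Nat using (ℕ; zero; suc; _≤_; _<_; _⊓_)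
open import Data.Fin using (Fin)
open import Data.Fin.Subset using (Subset; _∈_; ∣_∣)
open import Data.Bool using (Bool; true; false)
open import Data.Product using (Σ; ∃; _×_; _,_)
open import Relation.Binary.PropositionalEquality using (_≡_; _≢_)
open import Relation.Nullary using (¬_)

record Graph : Set where
  field
    n      : ℕ
    adj    : Fin n → Fin n → Bool
    sym    : ∀ u v → adj u v ≡ adj v u
    irrefl : ∀ u → adj u u ≡ false
open Graph public

data Walk (G : Graph) : Fin (n G) → Fin (n G) → ℕ → Set where
  here : ∀ u → Walk G u u zero
  step : ∀ {u v w k} → adj G u v ≡ true → Walk G v w k → Walk G u w (suc k)

Connected : Graph → Set
Connected G = (1 ≤ n G) × (∀ u v → ∃ λ k → Walk G u v k)

Dist : (G : Graph) → Fin (n G) → Fin (n G) → ℕ → Set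
Dist G u w k = Walk G u w k × (∀ j → Walk G u w j → k ≤ j)

-- Edges: ordered pairs of adjacent vertices (an edge xy is represented by (x,y) or (y,x)).
Edge : Graph → Set
Edge G = Σ (Fin (n G)) λ x → Σ (Fin (n G)) λ y → adj G x y ≡ true

SameEdge : (G : Graph) → Edge G → Edge G → Set
SameEdge G (x , y , _) (x' , y' , _) = ((x ≡ x') × (y ≡ y')) ⊎' ((x ≡ y') × (y ≡ x'))
  where
    open import Data.Sum using () renaming (_⊎_ to _⊎'_)

EDist : (G : Graph) → Edge G → Fin (n G) → ℕ → Set
EDist G (x , y , _) v k = ∃ λ a → ∃ λ b → Dist G x v a × Dist G y v b × (k ≡ a ⊓ b)

Distinguishes : (G : Graph) → Fin (n G) → Edge G → Edge G → Set
Distinguishes G v e₁ e₂ = ∃ λ k₁ → ∃ λ k₂ → EDist G e₁ v k₁ × EDist G e₂ v k₂ × (k₁ ≢ k₂)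

EdgeResolving : (G : Graph) → Subset (n G) → Set
EdgeResolving G S = ∀ (e₁ e₂ : Edge G) → ¬ SameEdge G e₁ e₂ →
  ∃ λ v → v ∈ S × Distinguishes G v e₁ e₂

IsEdim : Graph → ℕ → Set
IsEdim G k = (∃ λ S → EdgeResolving G S × ∣ S ∣ ≡ k)
           × (∀ S → EdgeResolving G S → k ≤ ∣ S ∣)

Subgraph : Graph → Graph → Set
Subgraph H G = Σ (Fin (n H) → Fin (n G)) λ f →
  (∀ u v → f u ≡ f v → u ≡ v) × (∀ u v → adj H u v ≡ true → adj G (f u) (f v) ≡ true)

{-# OPTIONS --safe #-}
-- Let G be the graph on {0,…,6} with edges 03 04 05 06 13 15 23 24, and H = G − 13.
-- In G the pair {1,2} separates all edges while no single vertex does, so edim G = 2;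
-- deleting 13 stretches d(1,2) from 2 to 4 and every 2-set then fails on some pair of
-- edges, so edim H = 3.  Once the distances are certified by explicit tables, both facts
-- are decidable statements about finitely many vertex sets and are checked by evaluation.
module Submission where

open import Defs
open import Axiom.UniquenessOfIdentityProofs using (module Decidable⇒UIP)
open import Data.Bool using (Bool; true; false; _∨_)
import Data.Bool as Bool
open import Data.Bool.Properties using (∨-comm)
open import Data.Empty using (⊥-elim)
open import Data.Fin using (Fin; toℕ; _≟_)
open import Data.Fin.Properties using (all?; any?)
open import Data.Fin.Subset using (Subset; _∈_; ∣_∣; inside; outside)
open import Data.Fin.Subset.Properties using (_∈?_; anySubset?)
open import Data.Nat using (ℕ; zero; suc; _≤_; _<_; _⊓_; z≤n; s≤s)
import Data.Nat as ℕ
open import Data.Nat.Properties using (≤-refl; ≤-reflexive; ≤-trans; ≤-antisym; ≮⇒≥; _≤?_; _<?_)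
open import Data.Product using (∃; _×_; _,_; proj₁; proj₂)
open import Data.Vec using (Vec; []; _∷_; lookup)
open import Relation.Nullary using (¬_; Dec; yes; no)
open import Relation.Nullary.Decidable using (_×-dec_; _⊎-dec_; _→-dec_; ¬?; map′; from-yes; from-no)
open import Relation.Binary.PropositionalEquality using (_≡_; _≢_; refl; trans; cong₂; subst)
import Relation.Binary.PropositionalEquality as ≡

module _ (G : Graph) where

  private
    V = Fin (n G)

  sameEdge? : (e₁ e₂ : Edge G) → Dec (SameEdge G e₁ e₂)
  sameEdge? (x , y , _) (x′ , y′ , _) = ((x ≟ x′) ×-dec (y ≟ y′)) ⊎-dec ((x ≟ y′) ×-dec (y ≟ x′))

  allEdges? : {P : Edge G → Set} → (∀ e → Dec (P e)) → Dec (∀ e → P e)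
  allEdges? {P} P? = map′ (λ h (x , y , xy) → h x y xy) (λ h x y xy → h (x , y , xy))
                          (all? λ x → all? λ y → atPair? x y)
    where
    atPair? : ∀ x y → Dec (∀ xy → P (x , y , xy))
    atPair? x y with adj G x y Bool.≟ true
    ... | no ¬xy = yes λ xy → ⊥-elim (¬xy xy)
    ... | yes xy = map′ (λ p xy′ → subst (λ q → P (x , y , q)) (Decidable⇒UIP.≡-irrelevant Bool._≟_ xy xy′) p)
                        (λ h → h xy) (P? (x , y , xy))

  StepTowards : (V → V → ℕ) → V → V → ℕ → Set
  StepTowards D u w zero    = u ≡ w
  StepTowards D u w (suc k) = ∃ λ v → adj G u v ≡ true × D v w ≡ k

  -- The second condition bounds every walk from below by the table, the third realises the table by a walk.
  IsDistanceTable : (V → V → ℕ) → Set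
  IsDistanceTable D = (∀ u → D u u ≡ 0)
                    × (∀ u v w → adj G u v ≡ true → D u w ≤ suc (D v w))
                    × (∀ u w → StepTowards D u w (D u w))

  isDistanceTable? : ∀ D → Dec (IsDistanceTable D)
  isDistanceTable? D = (all? λ u → D u u ℕ.≟ 0)
    ×-dec (all? λ u → all? λ v → all? λ w → (adj G u v Bool.≟ true) →-dec (D u w ≤? suc (D v w)))
    ×-dec (all? λ u → all? λ w → stepTowards? u w (D u w))
    where
    stepTowards? : ∀ u w k → Dec (StepTowards D u w k)
    stepTowards? u w zero    = u ≟ w
    stepTowards? u w (suc k) = any? λ v → (adj G u v Bool.≟ true) ×-dec (D v w ℕ.≟ k)

  module DistanceTable (D : V → V → ℕ) (isDistanceTable : IsDistanceTable D) where

    private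
      diagonal  = proj₁ isDistanceTable
      lipschitz = proj₁ (proj₂ isDistanceTable)
      descent   = proj₂ (proj₂ isDistanceTable)

    table≤length : ∀ {u w k} → Walk G u w k → D u w ≤ k
    table≤length (here u) = ≤-reflexive (diagonal u)
    table≤length {u} {w} (step {v = v} uv walk) = ≤-trans (lipschitz u v w uv) (s≤s (table≤length walk))

    walkOfLength : ∀ k u w → D u w ≡ k → Walk G u w k
    walkOfLength k u w Duw≡k = go k u (subst (StepTowards D u w) Duw≡k (descent u w))
      where
      go : ∀ k u → StepTowards D u w k → Walk G u w k
      go zero    u refl            = here u
      go (suc k) u (v , uv , Dvw≡k) = step uv (walkOfLength k v w Dvw≡k)

    dist : ∀ u w → Dist G u w (D u w)
    dist u w = walkOfLength (D u w) u w refl , λ _ → table≤length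

    dist-unique : ∀ {u w k} → Dist G u w k → k ≡ D u w
    dist-unique {u} {w} (walk , shortest) = ≤-antisym (shortest _ (proj₁ (dist u w))) (table≤length walk)

    connected : 1 ≤ n G → Connected G
    connected nonempty = nonempty , λ u w → D u w , proj₁ (dist u w)

    edgeDist : Edge G → V → ℕ
    edgeDist (x , y , _) v = D x v ⊓ D y v

    eDist : ∀ e v → EDist G e v (edgeDist e v)
    eDist (x , y , _) v = D x v , D y v , dist x v , dist y v , refl

    eDist-unique : ∀ e v {k} → EDist G e v k → k ≡ edgeDist e v
    eDist-unique (x , y , _) v (a , b , da , db , k≡a⊓b) = trans k≡a⊓b (cong₂ _⊓_ (dist-unique da) (dist-unique db))

    Resolves : Subset (n G) → Set
    Resolves S = ∀ e₁ e₂ → ¬ SameEdge G e₁ e₂ → ∃ λ v → v ∈ S × edgeDist e₁ v ≢ edgeDist e₂ v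

    resolves? : ∀ S → Dec (Resolves S)
    resolves? S = allEdges? λ e₁ → allEdges? λ e₂ → ¬? (sameEdge? e₁ e₂) →-dec
      any? λ v → (v ∈? S) ×-dec ¬? (edgeDist e₁ v ℕ.≟ edgeDist e₂ v)

    resolves⇒edgeResolving : ∀ {S} → Resolves S → EdgeResolving G S
    resolves⇒edgeResolving res e₁ e₂ e₁≢e₂ with res e₁ e₂ e₁≢e₂
    ... | v , v∈S , ≢ = v , v∈S , _ , _ , eDist e₁ v , eDist e₂ v , ≢

    edgeResolving⇒resolves : ∀ {S} → EdgeResolving G S → Resolves S
    edgeResolving⇒resolves res e₁ e₂ e₁≢e₂ with res e₁ e₂ e₁≢e₂
    ... | v , v∈S , _ , _ , d₁ , d₂ , ≢ =
      v , v∈S , λ eq → ≢ (trans (eDist-unique e₁ v d₁) (trans eq (≡.sym (eDist-unique e₂ v d₂))))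

    isEdim : ∀ (S : Subset (n G)) → Resolves S → ¬ (∃ λ (T : Subset (n G)) → ∣ T ∣ < ∣ S ∣ × Resolves T) → IsEdim G ∣ S ∣
    isEdim S resS minimal =
        (S , resolves⇒edgeResolving resS , refl)
      , λ T resT → ≮⇒≥ λ T<S → minimal (T , T<S , edgeResolving⇒resolves resT)

    smaller? : ∀ (S : Subset (n G)) → Dec (∃ λ (T : Subset (n G)) → ∣ T ∣ < ∣ S ∣ × Resolves T)
    smaller? S = anySubset? λ T → (∣ T ∣ <? ∣ S ∣) ×-dec resolves? T

undirected : ∀ {k} → (ℕ → ℕ → Bool) → Fin k → Fin k → Bool
undirected edge u v = edge (toℕ u) (toℕ v) ∨ edge (toℕ v) (toℕ u)

undirected-sym : ∀ {k} edge (u v : Fin k) → undirected edge u v ≡ undirected edge v u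
undirected-sym edge u v = ∨-comm (edge (toℕ u) (toℕ v)) (edge (toℕ v) (toℕ u))

edgesG : ℕ → ℕ → Bool
edgesG 0 3 = true
edgesG 0 4 = true
edgesG 0 5 = true
edgesG 0 6 = true
edgesG 1 3 = true
edgesG 1 5 = true
edgesG 2 3 = true
edgesG 2 4 = true
edgesG _ _ = false

edgesH : ℕ → ℕ → Bool
edgesH 1 3 = false
edgesH a b = edgesG a b

G₀ : Graph
G₀ = record
  { n = 7 ; adj = undirected edgesG ; sym = undirected-sym edgesG
  ; irrefl = from-yes (all? λ (u : Fin 7) → undirected edgesG u u Bool.≟ false) }

H₀ : Graph
H₀ = record
  { n = 7 ; adj = undirected edgesH ; sym = undirected-sym edgesH
  ; irrefl = from-yes (all? λ (u : Fin 7) → undirected edgesH u u Bool.≟ false) }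

table : Vec (Vec ℕ 7) 7 → Fin 7 → Fin 7 → ℕ
table rows u v = lookup (lookup rows u) v

distG : Fin 7 → Fin 7 → ℕ
distG = table
  ( (0 ∷ 2 ∷ 2 ∷ 1 ∷ 1 ∷ 1 ∷ 1 ∷ [])
  ∷ (2 ∷ 0 ∷ 2 ∷ 1 ∷ 3 ∷ 1 ∷ 3 ∷ [])
  ∷ (2 ∷ 2 ∷ 0 ∷ 1 ∷ 1 ∷ 3 ∷ 3 ∷ [])
  ∷ (1 ∷ 1 ∷ 1 ∷ 0 ∷ 2 ∷ 2 ∷ 2 ∷ [])
  ∷ (1 ∷ 3 ∷ 1 ∷ 2 ∷ 0 ∷ 2 ∷ 2 ∷ [])
  ∷ (1 ∷ 1 ∷ 3 ∷ 2 ∷ 2 ∷ 0 ∷ 2 ∷ [])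
  ∷ (1 ∷ 3 ∷ 3 ∷ 2 ∷ 2 ∷ 2 ∷ 0 ∷ [])
  ∷ [])

distH : Fin 7 → Fin 7 → ℕ
distH = table
  ( (0 ∷ 2 ∷ 2 ∷ 1 ∷ 1 ∷ 1 ∷ 1 ∷ [])
  ∷ (2 ∷ 0 ∷ 4 ∷ 3 ∷ 3 ∷ 1 ∷ 3 ∷ [])
  ∷ (2 ∷ 4 ∷ 0 ∷ 1 ∷ 1 ∷ 3 ∷ 3 ∷ [])
  ∷ (1 ∷ 3 ∷ 1 ∷ 0 ∷ 2 ∷ 2 ∷ 2 ∷ [])
  ∷ (1 ∷ 3 ∷ 1 ∷ 2 ∷ 0 ∷ 2 ∷ 2 ∷ [])
  ∷ (1 ∷ 1 ∷ 3 ∷ 2 ∷ 2 ∷ 0 ∷ 2 ∷ [])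
  ∷ (1 ∷ 3 ∷ 3 ∷ 2 ∷ 2 ∷ 2 ∷ 0 ∷ [])
  ∷ [])

module DG = DistanceTable G₀ distG (from-yes (isDistanceTable? G₀ distG))
module DH = DistanceTable H₀ distH (from-yes (isDistanceTable? H₀ distH))

resolvingG : Subset 7
resolvingG = outside ∷ inside ∷ inside ∷ outside ∷ outside ∷ outside ∷ outside ∷ []

resolvingH : Subset 7
resolvingH = outside ∷ inside ∷ inside ∷ inside ∷ outside ∷ outside ∷ outside ∷ []

edimG : IsEdim G₀ 2
edimG = DG.isEdim resolvingG (from-yes (DG.resolves? resolvingG)) (from-no (DG.smaller? resolvingG))

edimH : IsEdim H₀ 3
edimH = DH.isEdim resolvingH (from-yes (DH.resolves? resolvingH)) (from-no (DH.smaller? resolvingH))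

H₀⊆G₀ : Subgraph H₀ G₀
H₀⊆G₀ = (λ u → u) , (λ _ _ u≡v → u≡v) ,
  from-yes (all? λ (u : Fin 7) → all? λ v → (undirected edgesH u v Bool.≟ true) →-dec (undirected edgesG u v Bool.≟ true))

mainTheorem5 : ∃ λ (G : Graph) → ∃ λ (H : Graph) → Connected G × Connected H × Subgraph H G × (∃ λ (k : ℕ) → ∃ λ (m : ℕ) → IsEdim G k × IsEdim H m × k < m)
mainTheorem5 = G₀ , H₀ , DG.connected (s≤s z≤n) , DH.connected (s≤s z≤n) , H₀⊆G₀ , 2 , 3 , edimG , edimH , ≤-refl
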